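{- Let $n$ be a positive integer. For any finite simple graph $H$, the strong product $K_n \boxtimes H$ is well-dominated if and only if $H$ is well-dominated.
   Context: All graphs are finite, simple and undirected. A set $D\subseteq V(X)$ is a dominating set of $X$ if every vertex of $X$ is in $D$ or adjacent to a vertex of $D$; it is minimal if no proper subset is dominating. $\gamma(X)$ is the minimum size of a dominating set, $\Gamma(X)$ the maximum size of a minimal dominating set; $X$ is well-dominated if $\gamma(X)=\Gamma(X)$. The strong product $G\boxtimes H$ has vertex set $V(G)\times V(H)$, and distinct $(g_1,h_1),(g_2,h_2)$ are adjacent iff ($g_1=g_2$ and $h_1h_2\in E(H)$) or ($h_1=h_2$ and $g_1g_2\in E(G)$) or ($g_1g_2\in E(G)$ and $h_1h_2\in E(H)$). $K_n$ is the complete graph of order $n$. -}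

module Defs where

open import Data.Nat using (ℕ; _*_; _≤_)
open import Data.Bool using (Bool; true; false; _∧_; _∨_; not)
open import Data.Fin using (Fin; remQuot; _≟_)
open import Data.Fin.Subset using (Subset; _∈_; _⊂_; ∣_∣)
open import Data.Product using (Σ; ∃; _×_; _,_)
open import Data.Sum using (_⊎_)
open import Relation.Binary.PropositionalEquality using (_≡_)
open import Relation.Nullary using (¬_)
open import Relation.Nullary.Decidable using (⌊_⌋)

record Graph (n : ℕ) : Set where
  field
    adj   : Fin n → Fin n → Bool
    adj-sym    : ∀ u v → adj u v ≡ adj v u
    adj-irrefl : ∀ v → adj v v ≡ false
open Graph public

module _ {n : ℕ} (adj : Fin n → Fin n → Bool) where

  Dominating : Subset n → Set
  Dominating D = ∀ v → v ∈ D ⊎ (∃ λ u → u ∈ D × adj u v ≡ true)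

  MinimalDominating : Subset n → Set
  MinimalDominating D = Dominating D × (∀ D′ → D′ ⊂ D → ¬ Dominating D′)

  IsDominationNumber : ℕ → Set
  IsDominationNumber k =
    (Σ (Subset n) λ D → Dominating D × ∣ D ∣ ≡ k) × (∀ D → Dominating D → k ≤ ∣ D ∣)

  IsUpperDominationNumber : ℕ → Set
  IsUpperDominationNumber k =
    (Σ (Subset n) λ D → MinimalDominating D × ∣ D ∣ ≡ k) × (∀ D → MinimalDominating D → ∣ D ∣ ≤ k)

  WellDominatedAdj : Set
  WellDominatedAdj = ∃ λ k → IsDominationNumber k × IsUpperDominationNumber k

WellDominated : ∀ {n} → Graph n → Set
WellDominated G = WellDominatedAdj (adj G)

Kadj : (n : ℕ) → Fin n → Fin n → Bool
Kadj n u v = not ⌊ u ≟ v ⌋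

K : (n : ℕ) → Graph n
K n = record { adj = Kadj n ; adj-sym = s ; adj-irrefl = i }
  where
  open import Relation.Binary.PropositionalEquality using (refl; sym)
  open import Relation.Nullary using (yes; no)
  s : ∀ u v → Kadj n u v ≡ Kadj n v u
  s u v with u ≟ v | v ≟ u
  ... | yes _ | yes _ = refl
  ... | no _  | no _  = refl
  ... | yes p | no q  = Data.Empty.⊥-elim (q (sym p)) where import Data.Empty
  ... | no p  | yes q = Data.Empty.⊥-elim (p (sym q)) where import Data.Empty
  i : ∀ v → Kadj n v v ≡ false
  i v with v ≟ v
  ... | yes _ = refl
  ... | no p  = Data.Empty.⊥-elim (p refl) where import Data.Empty

-- Strong product adjacency on V(G) × V(H), with V(G) × V(H) encoded as
-- Fin (m * n) via remQuot (pair (g , h)).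
strongAdj : ∀ {m n} → Graph m → Graph n → Fin (m * n) → Fin (m * n) → Bool
strongAdj {m} {n} G H x y with remQuot {m} n x | remQuot {m} n y
... | (g₁ , h₁) | (g₂ , h₂) =
  (⌊ g₁ ≟ g₂ ⌋ ∧ adj H h₁ h₂) ∨ (⌊ h₁ ≟ h₂ ⌋ ∧ adj G g₁ g₂) ∨ (adj G g₁ g₂ ∧ adj H h₁ h₂)

StrongProductWellDominated : ∀ {m n} → Graph m → Graph n → Set
StrongProductWellDominated G H = WellDominatedAdj (strongAdj G H)

-- In G ⊠ H the closed neighbourhood of (g , h) is N[g] × N[h], so in Kₙ ⊠ H it is
-- V(Kₙ) × N[h]: the product is H with every vertex blown up into a clique. Projecting a
-- dominating set of the blow-up gives a dominating set of H, and any set meeting the fibres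
-- over a dominating set of H dominates the blow-up. A minimal dominating set of the blow-up
-- meets each fibre at most once (a second vertex in the same fibre could be dropped), so
-- projection preserves its size and its minimality; together with the lift of H into a
-- single copy this gives γ(Kₙ ⊠ H) = γ(H) and Γ(Kₙ ⊠ H) = Γ(H).
module Submission where

open import Defs
open import Data.Nat using (ℕ; NonZero; suc; _*_; _≤_; s≤s)
open import Data.Nat.Properties using (≤-trans; ≤-reflexive; ≤-antisym)
open import Data.Bool using (Bool; true; false; _∧_; _∨_)
open import Data.Bool.Properties using (∨-zeroʳ; ∨-inverseʳ)
open import Data.Fin using (Fin; zero; suc; combine; remQuot; _≟_)
open import Data.Fin.Properties using (0≢1+n; suc-injective; remQuot-combine; combine-remQuot)
open import Data.Fin.Subset
  using (Subset; inside; outside; ⊥; ⁅_⁆; _∪_; _-_; _∈_; _∉_; _⊆_; _⊂_; ∣_∣)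
open import Data.Fin.Subset.Properties
  using (∉⊥; x∈⁅x⁆; x∈⁅y⁆⇒x≡y; x∈p∪q⁺; x∈p∪q⁻; ∪-identityˡ; ∣⊥∣≡0; ∣p∣≤∣x∷p∣
        ; x∈p∧x≢y⇒x∈p-y; x∈p⇒p-x⊂p)
open import Data.Vec using ([]; _∷_; here; there)
open import Data.Product using (∃; _×_; _,_; proj₁; proj₂; uncurry)
open import Data.Sum using (inj₁; inj₂)
open import Data.Empty using (⊥-elim-irr)
open import Function using (_∘_; _⇔_; mk⇔; Equivalence)
open import Relation.Binary.PropositionalEquality
open import Relation.Nullary using (yes; no; contradiction)
open import Relation.Nullary.Decidable using (⌊_⌋; isYes≗does; dec-true; dec-false)

closedAdj : ∀ {n} → (Fin n → Fin n → Bool) → Fin n → Fin n → Bool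
closedAdj adj u v = ⌊ u ≟ v ⌋ ∨ adj u v

module _ {n} {adj : Fin n → Fin n → Bool} where

  closedAdj-refl : ∀ v → closedAdj adj v v ≡ true
  closedAdj-refl v with v ≟ v
  ... | yes _   = refl
  ... | no v≢v = contradiction refl v≢v

  dominating⇔ : ∀ {D} → Dominating adj D ⇔ (∀ v → ∃ λ u → u ∈ D × closedAdj adj u v ≡ true)
  dominating⇔ {D} = mk⇔ to from
    where
    to : Dominating adj D → ∀ v → ∃ λ u → u ∈ D × closedAdj adj u v ≡ true
    to dom v with dom v
    ... | inj₁ v∈D              = v , v∈D , closedAdj-refl v
    ... | inj₂ (u , u∈D , u~v) = u , u∈D , trans (cong (⌊ u ≟ v ⌋ ∨_) u~v) (∨-zeroʳ _)

    from : (∀ v → ∃ λ u → u ∈ D × closedAdj adj u v ≡ true) → Dominating adj D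
    from dom v with dom v
    ... | u , u∈D , u~v with u ≟ v
    ...   | yes refl = inj₁ u∈D
    ...   | no _     = inj₂ (u , u∈D , u~v)

image : ∀ {a b} → (Fin a → Fin b) → Subset a → Subset b
image f []            = ⊥
image f (outside ∷ p) = image (f ∘ suc) p
image f (inside ∷ p)  = ⁅ f zero ⁆ ∪ image (f ∘ suc) p

∈-image⁺ : ∀ {a b} {f : Fin a → Fin b} {p x} → x ∈ p → f x ∈ image f p
∈-image⁺ {p = inside ∷ p}  here        = x∈p∪q⁺ (inj₁ (x∈⁅x⁆ _))
∈-image⁺ {p = inside ∷ p}  (there x∈p) = x∈p∪q⁺ (inj₂ (∈-image⁺ x∈p))
∈-image⁺ {p = outside ∷ p} (there x∈p) = ∈-image⁺ x∈p

∈-image⁻ : ∀ {a b} (f : Fin a → Fin b) p {y} → y ∈ image f p → ∃ λ x → x ∈ p × f x ≡ y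
∈-image⁻ f []            y∈⊥ = contradiction y∈⊥ ∉⊥
∈-image⁻ f (outside ∷ p) y∈  with x , x∈p , fx≡y ← ∈-image⁻ (f ∘ suc) p y∈ =
  suc x , there x∈p , fx≡y
∈-image⁻ f (inside ∷ p)  y∈  with x∈p∪q⁻ ⁅ f zero ⁆ (image (f ∘ suc) p) y∈
... | inj₁ y∈⁅f0⁆ = zero , here , sym (x∈⁅y⁆⇒x≡y _ y∈⁅f0⁆)
... | inj₂ y∈     with x , x∈p , fx≡y ← ∈-image⁻ (f ∘ suc) p y∈ =
  suc x , there x∈p , fx≡y

∈-image-remove : ∀ {a b} {f : Fin a → Fin b} {p x y} → y ∈ image f p → y ≢ f x → y ∈ image f (p - x)
∈-image-remove {f = f} {p} {x} y∈ y≢fx with x′ , x′∈p , fx′≡y ← ∈-image⁻ f p y∈ =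
  subst (_∈ image f (p - x)) fx′≡y
    (∈-image⁺ (x∈p∧x≢y⇒x∈p-y x′∈p λ x′≡x → y≢fx (trans (sym fx′≡y) (cong f x′≡x))))

∣⁅x⁆∪p∣≤1+∣p∣ : ∀ {n} (x : Fin n) p → ∣ ⁅ x ⁆ ∪ p ∣ ≤ suc ∣ p ∣
∣⁅x⁆∪p∣≤1+∣p∣ zero    (t ∷ p)       rewrite ∪-identityˡ p = s≤s (∣p∣≤∣x∷p∣ t p)
∣⁅x⁆∪p∣≤1+∣p∣ (suc x) (inside ∷ p)  = s≤s (∣⁅x⁆∪p∣≤1+∣p∣ x p)
∣⁅x⁆∪p∣≤1+∣p∣ (suc x) (outside ∷ p) = ∣⁅x⁆∪p∣≤1+∣p∣ x p

x∉p⇒∣⁅x⁆∪p∣≡1+∣p∣ : ∀ {n} {x : Fin n} {p} → x ∉ p → ∣ ⁅ x ⁆ ∪ p ∣ ≡ suc ∣ p ∣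
x∉p⇒∣⁅x⁆∪p∣≡1+∣p∣ {x = zero}  {outside ∷ p} x∉p = cong (suc ∘ ∣_∣) (∪-identityˡ p)
x∉p⇒∣⁅x⁆∪p∣≡1+∣p∣ {x = zero}  {inside ∷ p}  x∉p = contradiction here x∉p
x∉p⇒∣⁅x⁆∪p∣≡1+∣p∣ {x = suc x} {inside ∷ p}  x∉p = cong suc (x∉p⇒∣⁅x⁆∪p∣≡1+∣p∣ (x∉p ∘ there))
x∉p⇒∣⁅x⁆∪p∣≡1+∣p∣ {x = suc x} {outside ∷ p} x∉p = x∉p⇒∣⁅x⁆∪p∣≡1+∣p∣ (x∉p ∘ there)

∣image∣≤∣p∣ : ∀ {a b} (f : Fin a → Fin b) p → ∣ image f p ∣ ≤ ∣ p ∣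
∣image∣≤∣p∣ {b = b} f [] = ≤-reflexive (∣⊥∣≡0 b)
∣image∣≤∣p∣ f (outside ∷ p) = ∣image∣≤∣p∣ (f ∘ suc) p
∣image∣≤∣p∣ f (inside ∷ p)  = ≤-trans (∣⁅x⁆∪p∣≤1+∣p∣ (f zero) _) (s≤s (∣image∣≤∣p∣ (f ∘ suc) p))

∣image∣≡∣p∣ : ∀ {a b} (f : Fin a → Fin b) p →
              (∀ {x x′} → x ∈ p → x′ ∈ p → f x ≡ f x′ → x ≡ x′) → ∣ image f p ∣ ≡ ∣ p ∣
∣image∣≡∣p∣ {b = b} f [] _ = ∣⊥∣≡0 b
∣image∣≡∣p∣ f (outside ∷ p) inj =
  ∣image∣≡∣p∣ (f ∘ suc) p (λ x∈p x′∈p e → suc-injective (inj (there x∈p) (there x′∈p) e))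
∣image∣≡∣p∣ f (inside ∷ p)  inj =
  trans (x∉p⇒∣⁅x⁆∪p∣≡1+∣p∣ f0∉) (cong suc (∣image∣≡∣p∣ (f ∘ suc) p
    (λ x∈p x′∈p e → suc-injective (inj (there x∈p) (there x′∈p) e))))
  where
  f0∉ : f zero ∉ image (f ∘ suc) p
  f0∉ f0∈ with x , x∈p , fx≡f0 ← ∈-image⁻ (f ∘ suc) p f0∈ = 0≢1+n (inj here (there x∈p) (sym fx≡f0))

-- π preserves and reflects closed adjacency, so X is Y with each vertex y blown up into
-- the clique π⁻¹(y), which is nonempty because σ is a section of π.
module CliqueBlowup
  {a b} (adjX : Fin a → Fin a → Bool) (adjY : Fin b → Fin b → Bool)
  (π : Fin a → Fin b) (σ : Fin b → Fin a) (π∘σ≗id : ∀ y → π (σ y) ≡ y)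
  (closedAdj-π : ∀ x x′ → closedAdj adjX x x′ ≡ closedAdj adjY (π x) (π x′))
  where

  open Equivalence

  image-dominating : ∀ {D} → Dominating adjX D → Dominating adjY (image π D)
  image-dominating dom = from dominating⇔ λ y →
    let u , u∈D , u~σy = to dominating⇔ dom (σ y)
    in π u , ∈-image⁺ u∈D , (begin
      closedAdj adjY (π u) y         ≡⟨ cong (closedAdj adjY (π u)) (π∘σ≗id y) ⟨
      closedAdj adjY (π u) (π (σ y)) ≡⟨ closedAdj-π u (σ y) ⟨
      closedAdj adjX u (σ y)         ≡⟨ u~σy ⟩
      true                           ∎)
    where open ≡-Reasoning

  dominating-lift : ∀ {D T} → T ⊆ image π D → Dominating adjY T → Dominating adjX D
  dominating-lift {D} T⊆ dom = from dominating⇔ λ x →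
    let y , y∈T , y~πx = to dominating⇔ dom (π x)
        u , u∈D , πu≡y = ∈-image⁻ π D (T⊆ y∈T)
    in u , u∈D , trans (closedAdj-π u x) (trans (cong (λ z → closedAdj adjY z (π x)) πu≡y) y~πx)

  σ-image-dominating : ∀ {T} → Dominating adjY T → Dominating adjX (image σ T)
  σ-image-dominating {T} = dominating-lift λ {y} y∈T →
    subst (_∈ image π (image σ T)) (π∘σ≗id y) (∈-image⁺ (∈-image⁺ y∈T))

  π-σ-image : ∀ {T u} → u ∈ image σ T → π u ∈ T
  π-σ-image {T} u∈ with y , y∈T , σy≡u ← ∈-image⁻ σ T u∈ =
    subst (_∈ T) (trans (sym (π∘σ≗id y)) (cong π σy≡u)) y∈T

  σ-π-image : ∀ {T u} → u ∈ image σ T → σ (π u) ≡ u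
  σ-π-image {T} u∈ with y , _ , refl ← ∈-image⁻ σ T u∈ = cong σ (π∘σ≗id y)

  ∣σ-image∣ : ∀ T → ∣ image σ T ∣ ≡ ∣ T ∣
  ∣σ-image∣ T = ∣image∣≡∣p∣ σ T λ {y} {y′} _ _ σy≡σy′ →
    trans (sym (π∘σ≗id y)) (trans (cong π σy≡σy′) (π∘σ≗id y′))

  minimal⇒π-injective : ∀ {D x x′} → MinimalDominating adjX D →
                        x ∈ D → x′ ∈ D → π x ≡ π x′ → x ≡ x′
  minimal⇒π-injective {D} {x} {x′} (dom , min) x∈D x′∈D πx≡πx′ with x ≟ x′
  ... | yes x≡x′ = x≡x′
  ... | no x≢x′  =
    contradiction (dominating-lift image⊆ (image-dominating dom)) (min (D - x′) (x∈p⇒p-x⊂p x′∈D))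
    where
    image⊆ : image π D ⊆ image π (D - x′)
    image⊆ {y} y∈ with y ≟ π x′
    ... | yes refl = subst (_∈ image π (D - x′)) πx≡πx′ (∈-image⁺ (x∈p∧x≢y⇒x∈p-y x∈D x≢x′))
    ... | no y≢πx′ = ∈-image-remove {f = π} {D} y∈ y≢πx′

  ∣π-image-minimal∣ : ∀ {D} → MinimalDominating adjX D → ∣ image π D ∣ ≡ ∣ D ∣
  ∣π-image-minimal∣ {D} md = ∣image∣≡∣p∣ π D (minimal⇒π-injective md)

  π-image-minimal : ∀ {D} → MinimalDominating adjX D → MinimalDominating adjY (image π D)
  π-image-minimal {D} (dom , min) = image-dominating dom , λ T (T⊆ , y , y∈ , y∉T) domT →
    let x , x∈D , πx≡y = ∈-image⁻ π D y∈
        T⊆image : T ⊆ image π (D - x)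
        T⊆image y′∈T = ∈-image-remove {f = π} {D} (T⊆ y′∈T) λ y′≡πx →
          y∉T (subst (_∈ T) (trans y′≡πx πx≡y) y′∈T)
    in min (D - x) (x∈p⇒p-x⊂p x∈D) (dominating-lift T⊆image domT)

  σ-image-minimal : ∀ {T} → MinimalDominating adjY T → MinimalDominating adjX (image σ T)
  σ-image-minimal {T} (dom , min) = σ-image-dominating dom , λ D D⊂ domD →
    min (image π D) (image⊂ D D⊂) (image-dominating domD)
    where
    image⊂ : ∀ D → D ⊂ image σ T → image π D ⊂ T
    image⊂ D (D⊆ , x , x∈ , x∉D) = image⊆ , π x , π-σ-image {T} x∈ , πx∉
      where
      image⊆ : image π D ⊆ T
      image⊆ y∈ with u , u∈D , refl ← ∈-image⁻ π D y∈ = π-σ-image {T} (D⊆ u∈D)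
      πx∉ : π x ∉ image π D
      πx∉ πx∈ with u , u∈D , πu≡πx ← ∈-image⁻ π D πx∈ =
        x∉D (subst (_∈ D) (trans (sym (σ-π-image {T} (D⊆ u∈D)))
                                 (trans (cong σ πu≡πx) (σ-π-image {T} x∈))) u∈D)

  isDominationNumber⇔ : ∀ {k} → IsDominationNumber adjX k ⇔ IsDominationNumber adjY k
  isDominationNumber⇔ {k} = mk⇔
    (λ ((D , dom , ∣D∣≡k) , lower) →
      let lowerY : ∀ T → Dominating adjY T → k ≤ ∣ T ∣
          lowerY T domT = subst (k ≤_) (∣σ-image∣ T) (lower (image σ T) (σ-image-dominating domT))
      in (image π D , image-dominating dom ,
          ≤-antisym (≤-trans (∣image∣≤∣p∣ π D) (≤-reflexive ∣D∣≡k))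
                    (lowerY _ (image-dominating dom))) ,
         lowerY)
    (λ ((T , dom , ∣T∣≡k) , lower) →
      (image σ T , σ-image-dominating dom , trans (∣σ-image∣ T) ∣T∣≡k) ,
      λ D domD → ≤-trans (lower _ (image-dominating domD)) (∣image∣≤∣p∣ π D))

  isUpperDominationNumber⇔ : ∀ {k} → IsUpperDominationNumber adjX k ⇔ IsUpperDominationNumber adjY k
  isUpperDominationNumber⇔ {k} = mk⇔
    (λ ((D , md , ∣D∣≡k) , upper) →
      (image π D , π-image-minimal md , trans (∣π-image-minimal∣ md) ∣D∣≡k) ,
      λ T mT → subst (_≤ k) (∣σ-image∣ T) (upper _ (σ-image-minimal mT)))
    (λ ((T , md , ∣T∣≡k) , upper) →
      (image σ T , σ-image-minimal md , trans (∣σ-image∣ T) ∣T∣≡k) ,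
      λ D mD → subst (_≤ k) (∣π-image-minimal∣ mD) (upper _ (π-image-minimal mD)))

  wellDominated⇔ : WellDominatedAdj adjX ⇔ WellDominatedAdj adjY
  wellDominated⇔ = mk⇔
    (λ (k , γ , Γ) → k , to isDominationNumber⇔ γ , to isUpperDominationNumber⇔ Γ)
    (λ (k , γ , Γ) → k , from isDominationNumber⇔ γ , from isUpperDominationNumber⇔ Γ)

⌊≟⌋-remQuot : ∀ {m n} (x y : Fin (m * n)) →
  let g , h = remQuot {m} n x ; g′ , h′ = remQuot {m} n y
  in ⌊ x ≟ y ⌋ ≡ ⌊ g ≟ g′ ⌋ ∧ ⌊ h ≟ h′ ⌋
⌊≟⌋-remQuot {m} {n} x y with proj₁ (remQuot {m} n x) ≟ proj₁ (remQuot {m} n y)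
                           | proj₂ (remQuot {m} n x) ≟ proj₂ (remQuot {m} n y)
... | yes g≡g′ | yes h≡h′ = trans (isYes≗does (x ≟ y)) (dec-true (x ≟ y) x≡y)
  where
  x≡y : x ≡ y
  x≡y = begin
    x                                  ≡⟨ combine-remQuot {m} n x ⟨
    uncurry combine (remQuot {m} n x) ≡⟨ cong₂ combine g≡g′ h≡h′ ⟩
    uncurry combine (remQuot {m} n y) ≡⟨ combine-remQuot {m} n y ⟩
    y                                  ∎
    where open ≡-Reasoning
... | no g≢g′  | _        =
  trans (isYes≗does (x ≟ y)) (dec-false (x ≟ y) (g≢g′ ∘ cong (proj₁ ∘ remQuot {m} n)))
... | yes _    | no h≢h′  =
  trans (isYes≗does (x ≟ y)) (dec-false (x ≟ y) (h≢h′ ∘ cong (proj₂ ∘ remQuot {m} n)))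

∨-∧-expand : ∀ e f a b → (e ∧ f) ∨ (e ∧ b) ∨ (f ∧ a) ∨ (a ∧ b) ≡ (e ∨ a) ∧ (f ∨ b)
∨-∧-expand true  true  _     _     = refl
∨-∧-expand true  false _     true  = refl
∨-∧-expand true  false true  false = refl
∨-∧-expand true  false false false = refl
∨-∧-expand false true  true  _     = refl
∨-∧-expand false true  false _     = refl
∨-∧-expand false false true  true  = refl
∨-∧-expand false false true  false = refl
∨-∧-expand false false false _     = refl

strong-closedAdj : ∀ {m n} (G : Graph m) (H : Graph n) (x y : Fin (m * n)) →
  let g , h = remQuot {m} n x ; g′ , h′ = remQuot {m} n y
  in closedAdj (strongAdj G H) x y ≡ closedAdj (adj G) g g′ ∧ closedAdj (adj H) h h′
strong-closedAdj {m} {n} G H x y =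
  trans (cong (_∨ strongAdj G H x y) (⌊≟⌋-remQuot {m} {n} x y))
        (∨-∧-expand ⌊ g ≟ g′ ⌋ ⌊ h ≟ h′ ⌋ (adj G g g′) (adj H h h′))
  where
  g = proj₁ (remQuot {m} n x) ; h = proj₂ (remQuot {m} n x)
  g′ = proj₁ (remQuot {m} n y) ; h′ = proj₂ (remQuot {m} n y)

K⊠-closedAdj : ∀ n {m} (H : Graph m) (x y : Fin (n * m)) →
  closedAdj (strongAdj (K n) H) x y
    ≡ closedAdj (adj H) (proj₂ (remQuot {n} m x)) (proj₂ (remQuot {n} m y))
K⊠-closedAdj n {m} H x y =
  trans (strong-closedAdj {n} {m} (K n) H x y)
        (cong (_∧ closedAdj (adj H) h h′) (∨-inverseʳ ⌊ g ≟ g′ ⌋))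
  where
  g = proj₁ (remQuot {n} m x) ; h = proj₂ (remQuot {n} m x)
  g′ = proj₁ (remQuot {n} m y) ; h′ = proj₂ (remQuot {n} m y)

theorem4 : (n : ℕ) → .{{_ : NonZero n}} → (m : ℕ) (H : Graph m) →
    StrongProductWellDominated (K n) H ⇔ WellDominated H
theorem4 (suc n) m H =
  CliqueBlowup.wellDominated⇔ (strongAdj (K (suc n)) H) (adj H) π σ π∘σ≗id (K⊠-closedAdj (suc n) H)
  where
  π : Fin (suc n * m) → Fin m
  π = proj₂ ∘ remQuot {suc n} m
  σ : Fin m → Fin (suc n * m)
  σ = combine {suc n} zero
  π∘σ≗id : ∀ h → π (σ h) ≡ h
  π∘σ≗id h = cong proj₂ (remQuot-combine {suc n} {m} zero h)
theorem4 0 {{nz}} = ⊥-elim-irr (NonZero.nonZero nz)
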